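{- Let $F:2^{\mathbb{N}}\to 2^{\mathbb{N}}$ be a function such that for every finite non-empty $s\subseteq\mathbb{N}$, $F(s)$ is non-empty and $\max(s)\le\min(F(s))$. Then $F$ is not $(\mathcal{U},\mathcal{P})$-definable.
   Context: $\mathbb{N}=\{0,1,2,\ldots\}$, $2^{\mathbb{N}}$ is its power set. A set-function is a map $(2^{\mathbb{N}})^k\to 2^{\mathbb{N}}$ for some $k\ge 0$. For a collection $\mathcal{O}$ of set-functions, $\mathcal{O}$-circuits are terms built from variables ranging over $2^{\mathbb{N}}$, the constants $\emptyset$, $\mathbb{N}$, $\{n\}$ ($n\in\mathbb{N}$), the operations $\cup$, $\cap$, complement relative to $\mathbb{N}$, and the functions in $\mathcal{O}$. A circuit with variables $x_1,\ldots,x_n$ ($n\ge1$) defines the function obtained by evaluation; a set-function is $\mathcal{O}$-definable if some $\mathcal{O}$-circuit defines it; "$(\mathcal{O}_1,\mathcal{O}_2)$-definable" means $(\mathcal{O}_1\cup\mathcal{O}_2)$-definable. For $s\subseteq\mathbb{N}$, $s_{|m}=s\cap\{0,\ldots,m\}$, componentwise on tuples. A set-function $G$ of arity $n$ is continuous at $\vec s$ if for every $m$ there is $n'$ such that for all $\vec t$, $\vec t_{|n'}=\vec s_{|n'}$ implies $G(\vec t)_{|m}=G(\vec s)_{|m}$. $\mathcal{U}$ is the collection of all set-functions (all arities) continuous everywhere; $\mathcal{P}$ is the collection of all set-functions (all arities) whose values all lie in $\{\emptyset,\{0\}\}$. -}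

module Defs where

open import Data.Nat using (ℕ; zero; suc; _≤_; _<_; _≟_)
open import Data.Bool using (Bool; true; false; _∨_; _∧_; not)
open import Data.Fin using (Fin)
import Data.Fin as Fin
open import Data.Product using (Σ; ∃; _×_; _,_)
open import Data.Sum using (_⊎_)
open import Relation.Nullary using (¬_; does)
open import Relation.Binary.PropositionalEquality using (_≡_)

SetN : Set
SetN = ℕ → Bool

_≈S_ : SetN → SetN → Set
s ≈S t = ∀ i → s i ≡ t i

∅S : SetN
∅S _ = false

ℕS : SetN
ℕS _ = true

singleton : ℕ → SetN
singleton n i = does (i ≟ n)

_∪S_ : SetN → SetN → SetN
(s ∪S t) i = s i ∨ t i

_∩S_ : SetN → SetN → SetN
(s ∩S t) i = s i ∧ t i

compS : SetN → SetN
compS s i = not (s i)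

SetFun : ℕ → Set
SetFun k = (Fin k → SetN) → SetN

AgreeUpTo : ∀ {k} → ℕ → (Fin k → SetN) → (Fin k → SetN) → Set
AgreeUpTo n t s = ∀ j i → i ≤ n → t j i ≡ s j i

SetAgreeUpTo : ℕ → SetN → SetN → Set
SetAgreeUpTo m a b = ∀ i → i ≤ m → a i ≡ b i

ContinuousAt : ∀ {k} → SetFun k → (Fin k → SetN) → Set
ContinuousAt {k} G s =
  ∀ (m : ℕ) → Σ ℕ λ n' → ∀ (t : Fin k → SetN) →
    AgreeUpTo n' t s → SetAgreeUpTo m (G t) (G s)

InU : ∀ {k} → SetFun k → Set
InU G = ∀ s → ContinuousAt G s

InP : ∀ {k} → SetFun k → Set
InP G = ∀ s → (G s ≈S ∅S) ⊎ (G s ≈S singleton 0)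

Collection : Set₁
Collection = (k : ℕ) → SetFun k → Set

data Circuit (O : Collection) (n : ℕ) : Set where
  var   : Fin n → Circuit O n
  empty : Circuit O n
  full  : Circuit O n
  sing  : ℕ → Circuit O n
  union : Circuit O n → Circuit O n → Circuit O n
  inter : Circuit O n → Circuit O n → Circuit O n
  compl : Circuit O n → Circuit O n
  app   : (k : ℕ) (G : SetFun k) → O k G → (Fin k → Circuit O n) → Circuit O n

eval : ∀ {O n} → Circuit O n → (Fin n → SetN) → SetN
eval (var i) ρ = ρ i
eval empty ρ = ∅S
eval full ρ = ℕS
eval (sing m) ρ = singleton m
eval (union c d) ρ = eval c ρ ∪S eval d ρ
eval (inter c d) ρ = eval c ρ ∩S eval d ρ
eval (compl c) ρ = compS (eval c ρ)
eval (app k G _ cs) ρ = G (λ j → eval (cs j) ρ)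

-- 𝒪-definability of an n-ary set-function (n ≥ 1).
Definable : Collection → (n : ℕ) → SetFun (suc n) → Set
Definable O n G =
  Σ (Circuit O (suc n)) λ c → ∀ ρ → eval c ρ ≈S G ρ

UP : Collection
UP k G = InU G ⊎ InP G

IsFinite : SetN → Set
IsFinite s = Σ ℕ λ b → ∀ i → b < i → s i ≡ false

NonEmpty : SetN → Set
NonEmpty s = Σ ℕ λ i → s i ≡ true

MaxLeMin : SetN → SetN → Set
MaxLeMin s t = ∀ i j → s i ≡ true → t j ≡ true → i ≤ j

unary : (SetN → SetN) → SetFun 1
unary F ρ = F (ρ Fin.zero)

module Submission where

-- Proof idea.  Call a list L of continuous unary functions a finite cover of
-- φ : 2^ℕ → 2^ℕ if for every input x some member h of L satisfies φ x = h x.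
--
-- (1) Every (𝒰,𝒫)-circuit in one variable has a finite cover.  Constants and
--     the variable are continuous; ∪, ∩ and complement are continuous
--     set-functions; a 𝒰-gate applied to covered arguments is covered by the
--     composites of the gate with all choices of members of the argument
--     covers; a 𝒫-gate only takes the two constant values ∅ and {0}.
-- (2) A function F as in the theorem has no finite cover.  Induction on the
--     cover, localised to the finite sets agreeing with a finite s ∋ 0 below
--     a bound B.  If a member h matches F at such a set t, pick j ∈ F(t) and
--     take N beyond B, j and the modulus of continuity of h at t for j.  On
--     the finite sets agreeing with t ∪ {N} up to N, h can never match F
--     again: it would put j into F(t'), while N ∈ t' forces N ≤ min F(t') ≤ j.
--     So the rest of the cover covers F there, against the induction
--     hypothesis; hence h never matches and the rest already covers near s.

open import Defs
open import Data.Product using (_×_)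
open import Relation.Nullary using (¬_)

open import Data.Nat using (ℕ; zero; suc; _≤_; _<_; _≟_; _⊔_; z≤n; s≤s)
open import Data.Nat.Properties
  using (≤-refl; ≤-trans; ≤-<-trans; m≤m⊔n; m≤n⊔m; m≤n⇒m≤1+n; <⇒≢; <⇒≱)
open import Data.Bool using (Bool; true; _∨_; _∧_; not)
open import Data.Bool.Properties using (∨-identityʳ; ∨-zeroʳ)
open import Data.Fin using (Fin)
open import Data.Vec.Functional using () renaming ([] to []ᵛ; _∷_ to _∷ᵛ_)
open import Data.List using (List; []; _∷_; map; cartesianProductWith)
open import Data.List.Relation.Unary.Any using (Any; here; there)
import Data.List.Relation.Unary.Any as Any
open import Data.List.Relation.Unary.Any.Properties using (map⁺; cartesianProductWith⁺)
open import Data.Product using (Σ; _,_; proj₁; proj₂)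
open import Data.Sum using (_⊎_; inj₁; inj₂)
open import Relation.Nullary.Decidable using (dec-true; dec-false)
open import Relation.Binary.PropositionalEquality
  using (_≡_; refl; sym; trans; cong; cong₂; module ≡-Reasoning)

agree-mono : ∀ {m n a b} → m ≤ n → SetAgreeUpTo n a b → SetAgreeUpTo m a b
agree-mono m≤n agree i i≤m = agree i (≤-trans i≤m m≤n)

Near : SetN → (SetN → Set) → Set
Near s X = Σ ℕ λ n → ∀ t → SetAgreeUpTo n t s → X t

near-× : ∀ {s X Y} → Near s X → Near s Y → Near s (λ t → X t × Y t)
near-× (n₁ , x) (n₂ , y) =
  n₁ ⊔ n₂ , λ t agree → x t (agree-mono (m≤m⊔n n₁ n₂) agree)
                      , y t (agree-mono (m≤n⊔m n₁ n₂) agree)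

near-∀ : ∀ {s} k {X : Fin k → SetN → Set} →
  (∀ j → Near s (X j)) → Near s (λ t → ∀ j → X j t)
near-∀ zero     _    = 0 , λ _ _ ()
near-∀ (suc k) nears with near-× (nears Fin.zero) (near-∀ k (λ j → nears (Fin.suc j)))
... | n , both = n , λ t agree → λ { Fin.zero    → proj₁ (both t agree)
                                   ; (Fin.suc j) → proj₂ (both t agree) j }

Continuous : (SetN → SetN) → Set
Continuous h = ∀ s m → Near s (λ t → SetAgreeUpTo m (h t) (h s))

ContFn : Set
ContFn = Σ (SetN → SetN) Continuous

constant : SetN → ContFn
constant x = (λ _ → x) , λ _ _ → 0 , λ _ _ _ _ → refl

identity : ContFn
identity = (λ x → x) , λ _ m → m , λ _ agree → agree

compose : ∀ {k} (G : SetFun k) → InU G → (Fin k → ContFn) → ContFn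
compose {k} G G-cont hs = (λ x → G (λ j → proj₁ (hs j) x)) , continuity
  where
  continuity : Continuous (λ x → G (λ j → proj₁ (hs j) x))
  continuity s m with G-cont (λ j → proj₁ (hs j) s) m
  ... | n , G-agree with near-∀ k (λ j → proj₂ (hs j) s n)
  ... | n' , args-agree = n' , λ t agree → G-agree _ (λ j → args-agree t agree j)

continuous-respects-≈ : ∀ {k} (G : SetFun k) → InU G →
  ∀ a b → (∀ j i → a j i ≡ b j i) → G a ≈S G b
continuous-respects-≈ G G-cont a b a≈b i =
  proj₂ (G-cont b i) a (λ j i' _ → a≈b j i') i ≤-refl

pointwise₂ : (Bool → Bool → Bool) → SetFun 2
pointwise₂ op ρ i = op (ρ Fin.zero i) (ρ (Fin.suc Fin.zero) i)

pointwise₂-continuous : ∀ op → InU (pointwise₂ op)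
pointwise₂-continuous op _ m =
  m , λ _ agree i i≤m → cong₂ op (agree Fin.zero i i≤m) (agree (Fin.suc Fin.zero) i i≤m)

complement : SetFun 1
complement ρ = compS (ρ Fin.zero)

complement-continuous : InU complement
complement-continuous _ m = m , λ _ agree i i≤m → cong not (agree Fin.zero i i≤m)

Covers : (SetN → SetN) → List ContFn → Set
Covers φ L = ∀ x → Any (λ h → φ x ≈S proj₁ h x) L

Covered : (SetN → SetN) → Set
Covered φ = Σ (List ContFn) (Covers φ)

choices : ∀ {A : Set} k → (Fin k → List A) → List (Fin k → A)
choices zero    _   = []ᵛ ∷ []
choices (suc k) Ls  = cartesianProductWith _∷ᵛ_ (Ls Fin.zero) (choices k (λ j → Ls (Fin.suc j)))

choices⁺ : ∀ {A : Set} k {Ls : Fin k → List A} {P : Fin k → A → Set} →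
  (∀ j → Any (P j) (Ls j)) → Any (λ as → ∀ j → P j (as j)) (choices k Ls)
choices⁺ zero    _     = here (λ ())
choices⁺ (suc k) {P = P} found =
  cartesianProductWith⁺ _∷ᵛ_ {P = P Fin.zero} {Q = λ as → ∀ j → P (Fin.suc j) (as j)}
    (λ p ps → λ { Fin.zero → p ; (Fin.suc j) → ps j })
    (found Fin.zero) (choices⁺ k (λ j → found (Fin.suc j)))

compose-covered : ∀ {k} (G : SetFun k) → InU G → (φ : Fin k → SetN → SetN) →
  (∀ j → Covered (φ j)) → Covered (λ x → G (λ j → φ j x))
compose-covered {k} G G-cont φ covered =
  map (compose G G-cont) (choices k (λ j → proj₁ (covered j))) , λ x →
    map⁺ (Any.map (λ args → continuous-respects-≈ G G-cont _ _ args)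
                  (choices⁺ k (λ j → proj₂ (covered j) x)))

𝒫-covered : ∀ {k} (G : SetFun k) → InP G → (φ : Fin k → SetN → SetN) →
  Covered (λ x → G (λ j → φ j x))
𝒫-covered G G-bool φ = constant ∅S ∷ constant (singleton 0) ∷ [] , λ x → value (G-bool _)
  where
  value : ∀ {x y} → (y ≈S ∅S) ⊎ (y ≈S singleton 0) →
    Any (λ h → y ≈S proj₁ h x) (constant ∅S ∷ constant (singleton 0) ∷ [])
  value (inj₁ y≈∅) = here y≈∅
  value (inj₂ y≈0) = there (here y≈0)

evalAt : ∀ {O} → Circuit O 1 → SetN → SetN
evalAt c x = eval c (λ _ → x)

circuit-covered : (c : Circuit UP 1) → Covered (evalAt c)
circuit-covered (var Fin.zero) = identity ∷ [] , λ _ → here (λ _ → refl)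
circuit-covered empty          = constant ∅S ∷ [] , λ _ → here (λ _ → refl)
circuit-covered full           = constant ℕS ∷ [] , λ _ → here (λ _ → refl)
circuit-covered (sing n)       = constant (singleton n) ∷ [] , λ _ → here (λ _ → refl)
circuit-covered (union c d)    =
  compose-covered (pointwise₂ _∨_) (pointwise₂-continuous _∨_) (evalAt c ∷ᵛ evalAt d ∷ᵛ []ᵛ)
    λ { Fin.zero → circuit-covered c ; (Fin.suc Fin.zero) → circuit-covered d }
circuit-covered (inter c d)    =
  compose-covered (pointwise₂ _∧_) (pointwise₂-continuous _∧_) (evalAt c ∷ᵛ evalAt d ∷ᵛ []ᵛ)
    λ { Fin.zero → circuit-covered c ; (Fin.suc Fin.zero) → circuit-covered d }
circuit-covered (compl c)      =
  compose-covered complement complement-continuous (evalAt c ∷ᵛ []ᵛ)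
    λ { Fin.zero → circuit-covered c }
circuit-covered (app k G (inj₁ G-cont) cs) =
  compose-covered G G-cont (λ j → evalAt (cs j)) (λ j → circuit-covered (cs j))
circuit-covered (app k G (inj₂ G-bool) cs) = 𝒫-covered G G-bool (λ j → evalAt (cs j))

adjoin-below : ∀ t {N i} → i < N → (t ∪S singleton N) i ≡ t i
adjoin-below t {N} {i} i<N =
  trans (cong (t i ∨_) (dec-false (i ≟ N) (<⇒≢ i<N))) (∨-identityʳ (t i))

adjoin-new : ∀ t N → (t ∪S singleton N) N ≡ true
adjoin-new t N = trans (cong (t N ∨_) (dec-true (N ≟ N) refl)) (∨-zeroʳ (t N))

adjoin-finite : ∀ {t} N → IsFinite t → IsFinite (t ∪S singleton N)
adjoin-finite {t} N (b , t-fin) = b ⊔ N , λ i b⊔N<i →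
  cong₂ _∨_ (t-fin i (≤-<-trans (m≤m⊔n b N) b⊔N<i))
            (dec-false (i ≟ N) (λ i≡N → <⇒≢ (≤-<-trans (m≤n⊔m b N) b⊔N<i) (sym i≡N)))

module NoFiniteCover (F : SetN → SetN)
  (F-spec : ∀ s → IsFinite s → NonEmpty s → NonEmpty (F s) × MaxLeMin s (F s)) where

  Nbhd : ℕ → SetN → SetN → Set
  Nbhd B s t = SetAgreeUpTo B t s × IsFinite t

  record Escape (h : ContFn) (B : ℕ) (t : SetN) : Set where
    field
      bound         : ℕ
      centre        : SetN
      centre-finite : IsFinite centre
      centre-zero   : centre 0 ≡ true
      inside        : ∀ {t'} → Nbhd bound centre t' → SetAgreeUpTo B t' t
      avoids        : ∀ {t'} → Nbhd bound centre t' → ¬ (F t' ≈S proj₁ h t')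

  escape : (h : ContFn) (B : ℕ) (t : SetN) →
    IsFinite t → t 0 ≡ true → F t ≈S proj₁ h t → Escape h B t
  escape (h , h-cont) B t t-fin t0 Ft≈ht = record
    { bound         = N
    ; centre        = t ∪S singleton N
    ; centre-finite = adjoin-finite N t-fin
    ; centre-zero   = trans (adjoin-below t {N} (s≤s z≤n)) t0
    ; inside        = λ near i i≤B → agrees-below-N near (≤-trans i≤B B≤M)
    ; avoids        = avoids
    }
    where
    j : ℕ
    j = proj₁ (proj₁ (F-spec t t-fin (0 , t0)))

    j∈Ft : F t j ≡ true
    j∈Ft = proj₂ (proj₁ (F-spec t t-fin (0 , t0)))

    -- Agreement with t up to n' makes h agree with h t at j.
    n' : ℕ
    n' = proj₁ (h-cont t j)

    M N : ℕ
    M = B ⊔ n' ⊔ j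
    N = suc M

    B≤M : B ≤ M
    B≤M = ≤-trans (m≤m⊔n B n') (m≤m⊔n (B ⊔ n') j)

    n'≤M : n' ≤ M
    n'≤M = ≤-trans (m≤n⊔m B n') (m≤m⊔n (B ⊔ n') j)

    agrees-below-N : ∀ {t'} → Nbhd N (t ∪S singleton N) t' → ∀ {i} → i ≤ M → t' i ≡ t i
    agrees-below-N (agree , _) {i} i≤M =
      trans (agree i (m≤n⇒m≤1+n i≤M)) (adjoin-below t (s≤s i≤M))

    avoids : ∀ {t'} → Nbhd N (t ∪S singleton N) t' → ¬ (F t' ≈S h t')
    avoids {t'} near@(agree , t'-fin) Ft'≈ht' = <⇒≱ (s≤s (m≤n⊔m (B ⊔ n') j)) N≤j
      where
      open ≡-Reasoning

      N∈t' : t' N ≡ true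
      N∈t' = trans (agree N ≤-refl) (adjoin-new t N)

      j∈Ft' : F t' j ≡ true
      j∈Ft' = begin
        F t' j ≡⟨ Ft'≈ht' j ⟩
        h t' j ≡⟨ proj₂ (h-cont t j) t' (λ i i≤n' → agrees-below-N near (≤-trans i≤n' n'≤M)) j ≤-refl ⟩
        h t j  ≡⟨ sym (Ft≈ht j) ⟩
        F t j  ≡⟨ j∈Ft ⟩
        true   ∎

      N≤j : N ≤ j
      N≤j = proj₂ (F-spec t' t'-fin (N , N∈t')) N j N∈t' j∈Ft'

  no-local-cover : (L : List ContFn) (s : SetN) (B : ℕ) → IsFinite s → s 0 ≡ true →
    ¬ (∀ t → Nbhd B s t → Any (λ h → F t ≈S proj₁ h t) L)
  no-local-cover []      s B s-fin s0 covers with covers s ((λ _ _ → refl) , s-fin)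
  ... | ()
  no-local-cover (h ∷ L) s B s-fin s0 covers =
    no-local-cover L s B s-fin s0 (λ t near → Any.tail (never t near) (covers t near))
    where
    -- h matches F nowhere near s: a match would yield, via escape, a smaller
    -- neighbourhood covered by L alone, contradicting the induction hypothesis.
    never : ∀ t → Nbhd B s t → ¬ (F t ≈S proj₁ h t)
    never t (agree , t-fin) Ft≈ht =
      no-local-cover L centre bound centre-finite centre-zero λ t' near' →
        Any.tail (avoids near')
          (covers t' ((λ i i≤B → trans (inside near' i i≤B) (agree i i≤B)) , proj₂ near'))
      where open Escape (escape h B t t-fin (trans (agree 0 z≤n) s0) Ft≈ht)

  no-finite-cover : ∀ L → ¬ Covers F L
  no-finite-cover L covers =
    no-local-cover L (singleton 0) 0 singleton0-finite refl (λ t _ → covers t)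
    where
    singleton0-finite : IsFinite (singleton 0)
    singleton0-finite = 0 , λ { (suc i) _ → refl }

theorem4 : (F : SetN → SetN) →
    (∀ s → IsFinite s → NonEmpty s → NonEmpty (F s) × MaxLeMin s (F s)) →
    ¬ Definable UP 0 (unary F)
theorem4 F F-spec (c , c≈F) = NoFiniteCover.no-finite-cover F F-spec L F-covered
  where
  L : List ContFn
  L = proj₁ (circuit-covered c)

  F-covered : Covers F L
  F-covered t = Any.map (λ c≈h i → trans (sym (c≈F (λ _ → t) i)) (c≈h i))
                        (proj₂ (circuit-covered c) t)
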